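{- Let $n$ and $d\le n$ be positive integers, $d'=d-1$, and let $\mathcal{G}_{\mathcal S}$ be the sphere graph defined in the context. Then the number of edges of $\mathcal{G}_{\mathcal S}$ is $$ e(\mathcal{G}_{\mathcal S})=\frac12\sum_{w=1}^{d'}\binom{n}{w}\left(\sum_{i=1}^{d'}\ \sum_{j=\lceil (w+i-d')/2\rceil^+}^{\min\{w,i\}}\binom{w}{j}\binom{n-w}{i-j}\;-\;1\right). $$
   Context: The sphere graph $\mathcal{G}_{\mathcal S}$ has as vertices the binary vectors of length $n$ of Hamming weight between $1$ and $d'=d-1$, two of them adjacent iff their Hamming distance is between $1$ and $d'$ (equivalently, it is the subgraph induced by the neighborhood of the zero vector in the graph on $\{0,1\}^n$ whose edges join vectors at Hamming distance between $1$ and $d-1$). For $x\in\mathbb{R}$, $\lceil x\rceil^+$ is the smallest nonnegative integer $m\ge x$. -}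

module Defs where

open import Data.Bool using (Bool; true; false; if_then_else_)
open import Data.Nat using (ℕ; zero; suc; _+_; _*_; _∸_; _≤_; _⊓_)
open import Data.Nat.DivMod using (_/_)
open import Data.Nat.Combinatorics using (_C_)
open import Data.Vec using (Vec; []; _∷_)
open import Data.List using (List; []; _∷_; _++_; map; filter; length; upTo)
open import Data.Nat.ListAction using (sum)
open import Data.Product using (_×_; _,_)
open import Relation.Nullary.Decidable using (_×-dec_)
open import Data.Nat.Properties using (_≤?_)

allVecs : (n : ℕ) → List (Vec Bool n)
allVecs zero = [] ∷ []
allVecs (suc n) = map (false ∷_) (allVecs n) ++ map (true ∷_) (allVecs n)

weight : ∀ {n} → Vec Bool n → ℕ
weight [] = 0
weight (true ∷ v) = suc (weight v)
weight (false ∷ v) = weight v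

hdist : ∀ {n} → Vec Bool n → Vec Bool n → ℕ
hdist [] [] = 0
hdist (a ∷ u) (b ∷ v) = (if a Data.Bool.xor b then 1 else 0) + hdist u v

sphereVertices : (n d : ℕ) → List (Vec Bool n)
sphereVertices n d = filter (λ v → (1 ≤? weight v) ×-dec (weight v ≤? d ∸ 1)) (allVecs n)

adjacent? : ∀ {n} (d : ℕ) (u v : Vec Bool n) → _
adjacent? d u v = (1 ≤? hdist u v) ×-dec (hdist u v ≤? d ∸ 1)

pairs : ∀ {A : Set} → List A → List (A × A)
pairs [] = []
pairs (x ∷ xs) = map (x ,_) xs ++ pairs xs

sphereEdges : (n d : ℕ) → ℕ
sphereEdges n d =
  length (filter (λ p → adjacent? d (Data.Product.proj₁ p) (Data.Product.proj₂ p))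
                 (pairs (sphereVertices n d)))

-- Σ_{k=a}^{b} f k  (empty when b < a)
sumFromTo : ℕ → ℕ → (ℕ → ℕ) → ℕ
sumFromTo a b f = sum (map (λ k → f (a + k)) (upTo (suc b ∸ a)))

-- ⌈ (w + i - d') / 2 ⌉⁺ : since ceiling of a negative/zero value is ≤ 0, truncated subtraction is exact
ceilHalfPos : ℕ → ℕ → ℕ → ℕ
ceilHalfPos w i d' = (w + i ∸ d' + 1) / 2

innerSum : (n d' w : ℕ) → ℕ
innerSum n d' w =
  sumFromTo 1 d' (λ i → sumFromTo (ceilHalfPos w i d') (w ⊓ i) (λ j → (w C j) * ((n ∸ w) C (i ∸ j))))

edgeFormulaTimes2 : (n d : ℕ) → ℕ
edgeFormulaTimes2 n d = sumFromTo 1 (d ∸ 1) (λ w → (n C w) * (innerSum n (d ∸ 1) w ∸ 1))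

{-# OPTIONS --safe #-}
-- Twice the number of edges is the sum of the degrees. Relative to a vertex u of weight w, a
-- vector v is described by its weight i and the number j of ones it shares with u: it lies at
-- distance w + i − 2j from u, and exactly C(w,j)·C(n−w,i−j) vectors have this profile. So the
-- degree of u depends only on w; the bound w + i − 2j ≤ d' reads j ≥ ⌈(w+i−d')/2⌉, and the only
-- profile at distance 0 is (w, w), that of u itself, which accounts for the −1. Summing over the
-- C(n,w) vertices of each weight w gives the formula.
module Submission where

open import Defs
import Algebra.Properties.CommutativeSemigroup as CommutativeSemigroupProperties
open import Data.Bool using (Bool; true; false; if_then_else_)
open import Data.List using (List; []; _∷_; _++_; map; filter; length; applyUpTo)
open import Data.Nat using (ℕ; zero; suc; _+_; _*_; _∸_; _≤_; _<_; _⊓_; z≤n; s≤s; s≤s⁻¹)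
open import Data.Nat.Combinatorics using (_C_; nCn≡1; k>n⇒nCk≡0; nCk+nC[k+1]≡[n+1]C[k+1])
open import Data.Nat.DivMod using (_/_; _%_; m≡m%n+[m/n]*n; m%n<n; m<n*o⇒m/o<n)
open import Data.Nat.ListAction using (sum)
open import Data.Nat.Properties
open import Data.Nat.Tactic.RingSolver using (solve-∀)
open import Data.Product using (_×_; _,_; proj₁; proj₂)
open import Data.Vec using (Vec; []; _∷_)
open import Function using (_∘_; _⇔_; mk⇔; Equivalence)
open import Function.Properties.Equivalence using () renaming (trans to ⇔-trans; sym to ⇔-sym)
open import Relation.Nullary using (Dec; yes; no; ¬_; does; contradiction)
open import Relation.Nullary.Decidable using (_×-dec_; does-⇔)
open import Relation.Binary.PropositionalEquality
  using (_≡_; _≢_; refl; sym; trans; cong; cong₂; subst; module ≡-Reasoning)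

module +-CS = CommutativeSemigroupProperties +-commutativeSemigroup
module *-CS = CommutativeSemigroupProperties *-commutativeSemigroup

private variable
  A : Set
  P Q : Set

-- Indicators and finite sums

-- Defined through `does` so that, e.g., 𝟙 (suc m ≟ suc n) and 𝟙 (m ≟ n) are definitionally equal.
𝟙 : Dec P → ℕ
𝟙 p = if does p then 1 else 0

𝟙-yes : (p : Dec P) → P → 𝟙 p ≡ 1
𝟙-yes (yes _) _ = refl
𝟙-yes (no ¬p) p = contradiction p ¬p

𝟙-no : (p : Dec P) → ¬ P → 𝟙 p ≡ 0
𝟙-no (yes p) ¬p = contradiction p ¬p
𝟙-no (no _) _ = refl

𝟙-cong : P ⇔ Q → (p : Dec P) (q : Dec Q) → 𝟙 p ≡ 𝟙 q
𝟙-cong P⇔Q p q = cong (λ b → if b then 1 else 0) (does-⇔ P⇔Q p q)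

𝟙-× : (p : Dec P) (q : Dec Q) → 𝟙 (p ×-dec q) ≡ 𝟙 p * 𝟙 q
𝟙-× (yes _) (yes _) = refl
𝟙-× (yes _) (no _) = refl
𝟙-× (no _) _ = refl

𝟙-*-cong : (p : Dec P) {x y : ℕ} → (P → x ≡ y) → 𝟙 p * x ≡ 𝟙 p * y
𝟙-*-cong (yes p) x≡y = cong (1 *_) (x≡y p)
𝟙-*-cong (no _) _ = refl

between : ℕ → ℕ → ℕ → ℕ
between a b k = 𝟙 ((a ≤? k) ×-dec (k ≤? b))

∑ : List A → (A → ℕ) → ℕ
∑ [] f = 0
∑ (x ∷ xs) f = f x + ∑ xs f

infix 5 ∑
syntax ∑ xs (λ x → e) = ∑[ x ∈ xs ] e

∑-cong : (xs : List A) {f g : A → ℕ} → (∀ x → f x ≡ g x) → ∑ xs f ≡ ∑ xs g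
∑-cong [] _ = refl
∑-cong (x ∷ xs) f≗g = cong₂ _+_ (f≗g x) (∑-cong xs f≗g)

∑-zero : (xs : List A) → ∑[ x ∈ xs ] 0 ≡ 0
∑-zero [] = refl
∑-zero (x ∷ xs) = ∑-zero xs

∑-distrib-+ : (xs : List A) (f g : A → ℕ) → ∑[ x ∈ xs ] (f x + g x) ≡ ∑ xs f + ∑ xs g
∑-distrib-+ [] f g = refl
∑-distrib-+ (x ∷ xs) f g =
  trans (cong (f x + g x +_) (∑-distrib-+ xs f g)) (+-CS.interchange (f x) (g x) _ _)

∑-distribˡ-* : (xs : List A) (c : ℕ) (f : A → ℕ) → ∑[ x ∈ xs ] c * f x ≡ c * ∑ xs f
∑-distribˡ-* [] c f = sym (*-zeroʳ c)
∑-distribˡ-* (x ∷ xs) c f =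
  trans (cong (c * f x +_) (∑-distribˡ-* xs c f)) (sym (*-distribˡ-+ c (f x) _))

∑-distribʳ-* : (xs : List A) (c : ℕ) (f : A → ℕ) → ∑[ x ∈ xs ] f x * c ≡ ∑ xs f * c
∑-distribʳ-* [] c f = refl
∑-distribʳ-* (x ∷ xs) c f =
  trans (cong (f x * c +_) (∑-distribʳ-* xs c f)) (sym (*-distribʳ-+ c (f x) _))

∑-++ : (xs ys : List A) (f : A → ℕ) → ∑ (xs ++ ys) f ≡ ∑ xs f + ∑ ys f
∑-++ [] ys f = refl
∑-++ (x ∷ xs) ys f = trans (cong (f x +_) (∑-++ xs ys f)) (sym (+-assoc (f x) _ _))

∑-map : {B : Set} (h : A → B) (xs : List A) (f : B → ℕ) → ∑ (map h xs) f ≡ ∑ xs (f ∘ h)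
∑-map h [] f = refl
∑-map h (x ∷ xs) f = cong (f (h x) +_) (∑-map h xs f)

∑-filter : {P : A → Set} (P? : ∀ x → Dec (P x)) (xs : List A) (f : A → ℕ) →
           ∑ (filter P? xs) f ≡ ∑[ x ∈ xs ] 𝟙 (P? x) * f x
∑-filter P? [] f = refl
∑-filter P? (x ∷ xs) f with P? x
... | yes _ = cong₂ _+_ (sym (+-identityʳ (f x))) (∑-filter P? xs f)
... | no _  = ∑-filter P? xs f

length-filter : {P : A → Set} (P? : ∀ x → Dec (P x)) (xs : List A) →
                length (filter P? xs) ≡ ∑[ x ∈ xs ] 𝟙 (P? x)
length-filter P? [] = refl
length-filter P? (x ∷ xs) with P? x
... | yes _ = cong suc (length-filter P? xs)
... | no _  = length-filter P? xs

∑-pairs : (R : A → A → ℕ) → (∀ x y → R x y ≡ R y x) → (∀ x → R x x ≡ 0) → (xs : List A) →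
          2 * (∑[ p ∈ pairs xs ] R (proj₁ p) (proj₂ p)) ≡ ∑[ x ∈ xs ] ∑[ y ∈ xs ] R x y
∑-pairs R sym-R irrefl-R [] = refl
∑-pairs R sym-R irrefl-R (x ∷ xs) = begin
    2 * ∑ (map (x ,_) xs ++ pairs xs) R′
  ≡⟨ cong (2 *_) (trans (∑-++ (map (x ,_) xs) (pairs xs) R′) (cong (_+ rest) (∑-map (x ,_) xs R′))) ⟩
    2 * (row + rest)
  ≡⟨ double row rest ⟩
    row + (row + 2 * rest)
  ≡⟨ cong₂ _+_ (cong (_+ row) (sym (irrefl-R x)))
               (cong₂ _+_ (∑-cong xs (sym-R x)) (∑-pairs R sym-R irrefl-R xs)) ⟩
    (R x x + row) + ((∑[ y ∈ xs ] R y x) + (∑[ y ∈ xs ] ∑[ z ∈ xs ] R y z))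
  ≡⟨ cong (R x x + row +_) (sym (∑-distrib-+ xs (λ y → R y x) (λ y → ∑ xs (R y)))) ⟩
    ∑[ y ∈ x ∷ xs ] ∑[ z ∈ x ∷ xs ] R y z ∎
  where
  open ≡-Reasoning
  R′ : _ → ℕ
  R′ p = R (proj₁ p) (proj₂ p)
  row = ∑ xs (R x)
  rest = ∑ (pairs xs) R′
  double : ∀ a b → 2 * (a + b) ≡ a + (a + 2 * b)
  double = solve-∀

∑< : ℕ → (ℕ → ℕ) → ℕ
∑< zero f = 0
∑< (suc N) f = f 0 + ∑< N (f ∘ suc)

infix 5 ∑<
syntax ∑< N (λ i → e) = ∑[ i < N ] e

∑<-cong : ∀ N {f g : ℕ → ℕ} → (∀ k → f k ≡ g k) → ∑< N f ≡ ∑< N g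
∑<-cong zero _ = refl
∑<-cong (suc N) f≗g = cong₂ _+_ (f≗g 0) (∑<-cong N (f≗g ∘ suc))

∑<-zero : ∀ N → ∑[ k < N ] 0 ≡ 0
∑<-zero zero = refl
∑<-zero (suc N) = ∑<-zero N

∑<-distrib-+ : ∀ N (f g : ℕ → ℕ) → ∑[ k < N ] (f k + g k) ≡ ∑< N f + ∑< N g
∑<-distrib-+ zero f g = refl
∑<-distrib-+ (suc N) f g =
  trans (cong (f 0 + g 0 +_) (∑<-distrib-+ N (f ∘ suc) (g ∘ suc))) (+-CS.interchange (f 0) (g 0) _ _)

∑<-distribˡ-* : ∀ N (c : ℕ) (f : ℕ → ℕ) → ∑[ k < N ] c * f k ≡ c * ∑< N f
∑<-distribˡ-* zero c f = sym (*-zeroʳ c)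
∑<-distribˡ-* (suc N) c f =
  trans (cong (c * f 0 +_) (∑<-distribˡ-* N c (f ∘ suc))) (sym (*-distribˡ-+ c (f 0) _))

∑<-δ : ∀ N {a} (f : ℕ → ℕ) → a < N → ∑[ i < N ] 𝟙 (a ≟ i) * f i ≡ f a
∑<-δ (suc N) {zero} f _ = trans (cong₂ _+_ (+-identityʳ (f 0)) (∑<-zero N)) (+-identityʳ (f 0))
∑<-δ (suc N) {suc a} f (s≤s a<N) = ∑<-δ N (f ∘ suc) a<N

∑<-𝟙≟ : ∀ N {a} → a < N → ∑[ i < N ] 𝟙 (a ≟ i) ≡ 1
∑<-𝟙≟ N {a} a<N = trans (∑<-cong N (λ i → sym (*-identityʳ (𝟙 (a ≟ i))))) (∑<-δ N (λ _ → 1) a<N)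

∑-∑<-comm : ∀ (xs : List A) N (f : A → ℕ → ℕ) →
            ∑[ x ∈ xs ] ∑< N (f x) ≡ ∑[ i < N ] ∑[ x ∈ xs ] f x i
∑-∑<-comm [] N f = sym (∑<-zero N)
∑-∑<-comm (x ∷ xs) N f = trans (cong (∑< N (f x) +_) (∑-∑<-comm xs N f))
                               (sym (∑<-distrib-+ N (f x) (λ i → ∑[ y ∈ xs ] f y i)))

sum-map-applyUpTo : ∀ (f g : ℕ → ℕ) m → sum (map f (applyUpTo g m)) ≡ ∑[ k < m ] f (g k)
sum-map-applyUpTo f g zero = refl
sum-map-applyUpTo f g (suc m) = cong (f (g 0) +_) (sum-map-applyUpTo f (g ∘ suc) m)

∑<-shift : ∀ a c (f : ℕ → ℕ) → ∑[ k < c ∸ a ] f (a + k) ≡ ∑[ k < c ] 𝟙 (a ≤? k) * f k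
∑<-shift zero c f = sym (∑<-cong c (λ k → *-identityˡ (f k)))
∑<-shift (suc a) zero f = refl
∑<-shift (suc a) (suc c) f = trans (∑<-shift a c (f ∘ suc)) (∑<-cong c 𝟙-suc≤)
  where
  𝟙-suc≤ : ∀ k → 𝟙 (a ≤? k) * f (suc k) ≡ 𝟙 (suc a ≤? suc k) * f (suc k)
  𝟙-suc≤ k = cong (_* f (suc k)) (𝟙-cong (mk⇔ s≤s s≤s⁻¹) (a ≤? k) (suc a ≤? suc k))

∑<-truncate : ∀ {m N} (f : ℕ → ℕ) → m ≤ N → ∑< m f ≡ ∑[ k < N ] 𝟙 (k <? m) * f k
∑<-truncate {zero} {N} f _ = sym (∑<-zero N)
∑<-truncate {suc m} {suc N} f (s≤s m≤N) =
  cong₂ _+_ (sym (*-identityˡ (f 0))) (∑<-truncate (f ∘ suc) m≤N)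

sumFromTo-∑< : ∀ a b {N} (f : ℕ → ℕ) → b < N → sumFromTo a b f ≡ ∑[ k < N ] between a b k * f k
sumFromTo-∑< a b {N} f b<N = begin
  sumFromTo a b f                                  ≡⟨ sum-map-applyUpTo (λ k → f (a + k)) (λ k → k) (suc b ∸ a) ⟩
  ∑[ k < suc b ∸ a ] f (a + k)                     ≡⟨ ∑<-shift a (suc b) f ⟩
  ∑[ k < suc b ] 𝟙 (a ≤? k) * f k                  ≡⟨ ∑<-truncate _ b<N ⟩
  ∑[ k < N ] 𝟙 (k <? suc b) * (𝟙 (a ≤? k) * f k)  ≡⟨ ∑<-cong N indicator ⟩
  ∑[ k < N ] between a b k * f k                   ∎
  where
  open ≡-Reasoning
  indicator : ∀ k → 𝟙 (k <? suc b) * (𝟙 (a ≤? k) * f k) ≡ between a b k * f k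
  indicator k = begin
    𝟙 (k <? suc b) * (𝟙 (a ≤? k) * f k) ≡⟨ cong (_* _) (𝟙-cong (mk⇔ s≤s⁻¹ s≤s) (k <? suc b) (k ≤? b)) ⟩
    𝟙 (k ≤? b) * (𝟙 (a ≤? k) * f k)     ≡⟨ *-CS.x∙yz≈yx∙z (𝟙 (k ≤? b)) (𝟙 (a ≤? k)) (f k) ⟩
    𝟙 (a ≤? k) * 𝟙 (k ≤? b) * f k       ≡⟨ cong (_* f k) (𝟙-× (a ≤? k) (k ≤? b)) ⟨
    between a b k * f k                 ∎

∑-fiber : ∀ {N : ℕ} (φ : A → ℕ) → (∀ x → φ x < N) → (xs : List A) (f : A → ℕ → ℕ) →
          ∑[ x ∈ xs ] f x (φ x) ≡ ∑[ i < N ] ∑[ x ∈ xs ] 𝟙 (φ x ≟ i) * f x i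
∑-fiber {N = N} φ φ<N xs f = trans (∑-cong xs (λ x → sym (∑<-δ N (f x) (φ<N x))))
                                   (∑-∑<-comm xs N (λ x i → 𝟙 (φ x ≟ i) * f x i))

∑-fiber₁ : ∀ {N : ℕ} (φ : A → ℕ) → (∀ x → φ x < N) → (xs : List A) (g : ℕ → ℕ) →
           ∑[ x ∈ xs ] g (φ x) ≡ ∑[ i < N ] (∑[ x ∈ xs ] 𝟙 (φ x ≟ i)) * g i
∑-fiber₁ {N = N} φ φ<N xs g = trans (∑-fiber φ φ<N xs (λ _ → g))
                                    (∑<-cong N (λ i → ∑-distribʳ-* xs (g i) (λ x → 𝟙 (φ x ≟ i))))

∑-fiber₂ : ∀ {N : ℕ} (φ ψ : A → ℕ) → (∀ x → φ x < N) → (∀ x → ψ x < N) →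
           (xs : List A) (g : ℕ → ℕ → ℕ) →
           ∑[ x ∈ xs ] g (φ x) (ψ x) ≡
           ∑[ i < N ] ∑[ j < N ] (∑[ x ∈ xs ] 𝟙 (φ x ≟ i) * 𝟙 (ψ x ≟ j)) * g i j
∑-fiber₂ {N = N} φ ψ φ<N ψ<N xs g = begin
    ∑[ x ∈ xs ] g (φ x) (ψ x)
  ≡⟨ ∑-fiber φ φ<N xs (λ x i → g i (ψ x)) ⟩
    ∑[ i < N ] ∑[ x ∈ xs ] 𝟙 (φ x ≟ i) * g i (ψ x)
  ≡⟨ ∑<-cong N (λ i → ∑-fiber ψ ψ<N xs (λ x j → 𝟙 (φ x ≟ i) * g i j)) ⟩
    ∑[ i < N ] ∑[ j < N ] ∑[ x ∈ xs ] 𝟙 (ψ x ≟ j) * (𝟙 (φ x ≟ i) * g i j)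
  ≡⟨ ∑<-cong N (λ i → ∑<-cong N (λ j → trans
       (∑-cong xs (λ x → *-CS.x∙yz≈yx∙z (𝟙 (ψ x ≟ j)) (𝟙 (φ x ≟ i)) (g i j)))
       (∑-distribʳ-* xs (g i j) (λ x → 𝟙 (φ x ≟ i) * 𝟙 (ψ x ≟ j))))) ⟩
    ∑[ i < N ] ∑[ j < N ] (∑[ x ∈ xs ] 𝟙 (φ x ≟ i) * 𝟙 (ψ x ≟ j)) * g i j ∎
  where open ≡-Reasoning

-- Arithmetic of profiles

+≡⇔ : ∀ {m n o} → m + n ≡ o ⇔ (m ≤ o × n ≡ o ∸ m)
+≡⇔ {m} {n} = mk⇔ (λ { refl → m≤m+n m n , sym (m+n∸m≡n m n) }) (λ { (m≤o , refl) → m+[n∸m]≡n m≤o })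

𝟙-+≟ : ∀ a b i → 𝟙 (a + b ≟ i) ≡ 𝟙 (a ≤? i) * 𝟙 (b ≟ i ∸ a)
𝟙-+≟ a b i = trans (𝟙-cong +≡⇔ (a + b ≟ i) ((a ≤? i) ×-dec (b ≟ i ∸ a))) (𝟙-× (a ≤? i) (b ≟ i ∸ a))

half≤⇔ : ∀ x j → (x + 1) / 2 ≤ j ⇔ x ≤ 2 * j
half≤⇔ x j = mk⇔ to from
  where
  open ≤-Reasoning
  to : (x + 1) / 2 ≤ j → x ≤ 2 * j
  to h = s≤s⁻¹ (begin
    suc x                           ≡⟨ +-comm 1 x ⟩
    x + 1                           ≡⟨ m≡m%n+[m/n]*n (x + 1) 2 ⟩
    (x + 1) % 2 + (x + 1) / 2 * 2   ≤⟨ +-mono-≤ (s≤s⁻¹ (m%n<n (x + 1) 2)) (*-monoˡ-≤ 2 h) ⟩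
    1 + j * 2                       ≡⟨ cong suc (*-comm j 2) ⟩
    suc (2 * j)                     ∎)
  from : x ≤ 2 * j → (x + 1) / 2 ≤ j
  from h = s≤s⁻¹ (m<n*o⇒m/o<n (begin-strict
    x + 1         ≡⟨ +-comm x 1 ⟩
    suc x         ≤⟨ s≤s h ⟩
    suc (2 * j)   ≡⟨ cong suc (*-comm 2 j) ⟩
    suc (j * 2)   <⟨ n<1+n _ ⟩
    suc j * 2     ∎))

∸≤⇔≤+ : ∀ m n o → m ∸ n ≤ o ⇔ m ≤ n + o
∸≤⇔≤+ m n o = mk⇔ (λ h → ≤-trans (m≤n+m∸n m n) (+-monoʳ-≤ n h)) (m≤n+o⇒m∸n≤o m n)

distance : ℕ → ℕ → ℕ → ℕ
distance w i j = w + i ∸ 2 * j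

ceilHalfPos≤⇔ : ∀ w i d' j → ceilHalfPos w i d' ≤ j ⇔ distance w i j ≤ d'
ceilHalfPos≤⇔ w i d' j =
  ⇔-trans (half≤⇔ (w + i ∸ d') j)
    (⇔-trans (∸≤⇔≤+ (w + i) d' (2 * j))
      (subst (λ k → w + i ≤ k ⇔ distance w i j ≤ d') (+-comm (2 * j) d') (⇔-sym (∸≤⇔≤+ (w + i) (2 * j) d'))))

distance-diagonal : ∀ w → distance w w w ≡ 0
distance-diagonal w = trans (cong (λ k → w + w ∸ (w + k)) (+-identityʳ w)) (n∸n≡0 (w + w))

distance≡0⇒ : ∀ {w i j} → j ≤ w → j ≤ i → distance w i j ≡ 0 → w ≡ j × i ≡ j
distance≡0⇒ {w} {i} {j} j≤w j≤i dist≡0 = ≤-antisym w≤j j≤w , ≤-antisym i≤j j≤i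
  where
  w+i≤j+j : w + i ≤ j + j
  w+i≤j+j = subst (w + i ≤_) (cong (j +_) (+-identityʳ j)) (m∸n≡0⇒m≤n dist≡0)
  w≤j : w ≤ j
  w≤j = +-cancelʳ-≤ i w j (≤-trans w+i≤j+j (+-monoʳ-≤ j j≤i))
  i≤j : i ≤ j
  i≤j = +-cancelˡ-≤ w i j (≤-trans w+i≤j+j (+-monoˡ-≤ j j≤w))

pascal : ∀ n k → n C suc k + n C k ≡ suc n C suc k
pascal n k = trans (+-comm (n C suc k) (n C k)) (nCk+nC[k+1]≡[n+1]C[k+1] n k)

-- Binary vectors

common : ∀ {n} → Vec Bool n → Vec Bool n → ℕ
common [] [] = 0
common (true ∷ u) (true ∷ v) = suc (common u v)
common (true ∷ u) (false ∷ v) = common u v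
common (false ∷ u) (_ ∷ v) = common u v

beyond : ∀ {n} → Vec Bool n → Vec Bool n → ℕ
beyond [] [] = 0
beyond (true ∷ u) (_ ∷ v) = beyond u v
beyond (false ∷ u) (true ∷ v) = suc (beyond u v)
beyond (false ∷ u) (false ∷ v) = beyond u v

weight-≤ : ∀ {n} (v : Vec Bool n) → weight v ≤ n
weight-≤ [] = z≤n
weight-≤ (true ∷ v) = s≤s (weight-≤ v)
weight-≤ (false ∷ v) = m≤n⇒m≤1+n (weight-≤ v)

weight≡common+beyond : ∀ {n} (u v : Vec Bool n) → weight v ≡ common u v + beyond u v
weight≡common+beyond [] [] = refl
weight≡common+beyond (true ∷ u) (true ∷ v) = cong suc (weight≡common+beyond u v)
weight≡common+beyond (true ∷ u) (false ∷ v) = weight≡common+beyond u v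
weight≡common+beyond (false ∷ u) (true ∷ v) =
  trans (cong suc (weight≡common+beyond u v)) (sym (+-suc (common u v) (beyond u v)))
weight≡common+beyond (false ∷ u) (false ∷ v) = weight≡common+beyond u v

common-≤ : ∀ {n} (u v : Vec Bool n) → common u v ≤ n
common-≤ u v =
  ≤-trans (subst (common u v ≤_) (sym (weight≡common+beyond u v)) (m≤m+n _ _)) (weight-≤ v)

hdist+2*common : ∀ {n} (u v : Vec Bool n) → hdist u v + 2 * common u v ≡ weight u + weight v
hdist+2*common [] [] = refl
hdist+2*common (true ∷ u) (true ∷ v) = begin
  hdist u v + 2 * suc (common u v)   ≡⟨ cong (hdist u v +_) (*-suc 2 (common u v)) ⟩
  hdist u v + (2 + 2 * common u v)   ≡⟨ +-CS.x∙yz≈y∙xz (hdist u v) 2 _ ⟩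
  2 + (hdist u v + 2 * common u v)   ≡⟨ cong (2 +_) (hdist+2*common u v) ⟩
  2 + (weight u + weight v)          ≡⟨ cong suc (+-suc (weight u) (weight v)) ⟨
  suc (weight u) + suc (weight v)    ∎
  where open ≡-Reasoning
hdist+2*common (true ∷ u) (false ∷ v) = cong suc (hdist+2*common u v)
hdist+2*common (false ∷ u) (true ∷ v) =
  trans (cong suc (hdist+2*common u v)) (sym (+-suc (weight u) (weight v)))
hdist+2*common (false ∷ u) (false ∷ v) = hdist+2*common u v

hdist≡distance : ∀ {n} (u v : Vec Bool n) → hdist u v ≡ distance (weight u) (weight v) (common u v)
hdist≡distance u v = trans (sym (m+n∸n≡m (hdist u v) (2 * common u v)))
                           (cong (_∸ 2 * common u v) (hdist+2*common u v))

hdist-sym : ∀ {n} (u v : Vec Bool n) → hdist u v ≡ hdist v u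
hdist-sym [] [] = refl
hdist-sym (true ∷ u) (true ∷ v) = hdist-sym u v
hdist-sym (true ∷ u) (false ∷ v) = cong suc (hdist-sym u v)
hdist-sym (false ∷ u) (true ∷ v) = cong suc (hdist-sym u v)
hdist-sym (false ∷ u) (false ∷ v) = hdist-sym u v

hdist-self : ∀ {n} (u : Vec Bool n) → hdist u u ≡ 0
hdist-self [] = refl
hdist-self (true ∷ u) = hdist-self u
hdist-self (false ∷ u) = hdist-self u

∑-allVecs-suc : ∀ n (f : Vec Bool (suc n) → ℕ) →
  ∑ (allVecs (suc n)) f ≡ (∑[ v ∈ allVecs n ] f (false ∷ v)) + (∑[ v ∈ allVecs n ] f (true ∷ v))
∑-allVecs-suc n f = trans (∑-++ (map (false ∷_) (allVecs n)) (map (true ∷_) (allVecs n)) f)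
                          (cong₂ _+_ (∑-map (false ∷_) (allVecs n) f) (∑-map (true ∷_) (allVecs n) f))

weight-count : ∀ n i → ∑[ v ∈ allVecs n ] 𝟙 (weight v ≟ i) ≡ n C i
weight-count zero zero = refl
weight-count zero (suc i) = refl
weight-count (suc n) zero =
  trans (∑-allVecs-suc n (λ v → 𝟙 (weight v ≟ 0))) (cong₂ _+_ (weight-count n 0) (∑-zero (allVecs n)))
weight-count (suc n) (suc i) =
  trans (∑-allVecs-suc n (λ v → 𝟙 (weight v ≟ suc i)))
        (trans (cong₂ _+_ (weight-count n (suc i)) (weight-count n i)) (pascal n i))

common-beyond-count : ∀ {n} (u : Vec Bool n) j k →
  ∑[ v ∈ allVecs n ] 𝟙 (common u v ≟ j) * 𝟙 (beyond u v ≟ k) ≡ (weight u C j) * ((n ∸ weight u) C k)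
common-beyond-count [] zero zero = refl
common-beyond-count [] zero (suc k) = refl
common-beyond-count [] (suc j) k = refl
common-beyond-count {suc n} (true ∷ u) zero k =
  trans (∑-allVecs-suc n _) (trans (cong₂ _+_ (common-beyond-count u 0 k) (∑-zero (allVecs n))) (+-identityʳ _))
common-beyond-count {suc n} (true ∷ u) (suc j) k = begin
    ∑[ v ∈ allVecs (suc n) ] 𝟙 (common (true ∷ u) v ≟ suc j) * 𝟙 (beyond (true ∷ u) v ≟ k)
  ≡⟨ ∑-allVecs-suc n _ ⟩
    count (suc j) k + count j k
  ≡⟨ cong₂ _+_ (common-beyond-count u (suc j) k) (common-beyond-count u j k) ⟩
    (w C suc j) * (z C k) + (w C j) * (z C k)
  ≡⟨ *-distribʳ-+ (z C k) (w C suc j) (w C j) ⟨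
    (w C suc j + w C j) * (z C k)
  ≡⟨ cong (_* (z C k)) (pascal w j) ⟩
    (suc w C suc j) * (z C k) ∎
  where
  open ≡-Reasoning
  w = weight u
  z = n ∸ weight u
  count : ℕ → ℕ → ℕ
  count j k = ∑[ v ∈ allVecs n ] 𝟙 (common u v ≟ j) * 𝟙 (beyond u v ≟ k)
common-beyond-count {suc n} (false ∷ u) j zero =
  trans (∑-allVecs-suc n _) (trans (cong₂ _+_ (common-beyond-count u j 0) no-beyond) (+-identityʳ _))
  where
  no-beyond : ∑[ v ∈ allVecs n ] 𝟙 (common u v ≟ j) * 0 ≡ 0
  no-beyond = trans (∑-cong (allVecs n) (λ v → *-zeroʳ (𝟙 (common u v ≟ j)))) (∑-zero (allVecs n))
common-beyond-count {suc n} (false ∷ u) j (suc k) = begin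
    ∑[ v ∈ allVecs (suc n) ] 𝟙 (common (false ∷ u) v ≟ j) * 𝟙 (beyond (false ∷ u) v ≟ suc k)
  ≡⟨ ∑-allVecs-suc n _ ⟩
    count j (suc k) + count j k
  ≡⟨ cong₂ _+_ (common-beyond-count u j (suc k)) (common-beyond-count u j k) ⟩
    (w C j) * (z C suc k) + (w C j) * (z C k)
  ≡⟨ *-distribˡ-+ (w C j) (z C suc k) (z C k) ⟨
    (w C j) * (z C suc k + z C k)
  ≡⟨ cong ((w C j) *_) (trans (pascal z k) (cong (_C suc k) (sym (+-∸-assoc 1 (weight-≤ u))))) ⟩
    (w C j) * ((suc n ∸ w) C suc k) ∎
  where
  open ≡-Reasoning
  w = weight u
  z = n ∸ weight u
  count : ℕ → ℕ → ℕ
  count j k = ∑[ v ∈ allVecs n ] 𝟙 (common u v ≟ j) * 𝟙 (beyond u v ≟ k)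

meetCount : ℕ → ℕ → ℕ → ℕ → ℕ
meetCount w z i j = 𝟙 (j ≤? i) * ((w C j) * (z C (i ∸ j)))

weight-common-count : ∀ {n} (u : Vec Bool n) i j →
  ∑[ v ∈ allVecs n ] 𝟙 (weight v ≟ i) * 𝟙 (common u v ≟ j) ≡ meetCount (weight u) (n ∸ weight u) i j
weight-common-count {n} u i j = begin
    ∑[ v ∈ allVecs n ] 𝟙 (weight v ≟ i) * 𝟙 (common u v ≟ j)
  ≡⟨ ∑-cong (allVecs n) split-weight ⟩
    ∑[ v ∈ allVecs n ] 𝟙 (j ≤? i) * (𝟙 (common u v ≟ j) * 𝟙 (beyond u v ≟ i ∸ j))
  ≡⟨ ∑-distribˡ-* (allVecs n) (𝟙 (j ≤? i)) _ ⟩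
    𝟙 (j ≤? i) * (∑[ v ∈ allVecs n ] 𝟙 (common u v ≟ j) * 𝟙 (beyond u v ≟ i ∸ j))
  ≡⟨ cong (𝟙 (j ≤? i) *_) (common-beyond-count u j (i ∸ j)) ⟩
    meetCount (weight u) (n ∸ weight u) i j ∎
  where
  open ≡-Reasoning
  split-weight : ∀ v → 𝟙 (weight v ≟ i) * 𝟙 (common u v ≟ j) ≡
                       𝟙 (j ≤? i) * (𝟙 (common u v ≟ j) * 𝟙 (beyond u v ≟ i ∸ j))
  split-weight v = begin
      𝟙 (weight v ≟ i) * 𝟙 (c ≟ j)               ≡⟨ *-comm _ (𝟙 (c ≟ j)) ⟩
      𝟙 (c ≟ j) * 𝟙 (weight v ≟ i)               ≡⟨ 𝟙-*-cong (c ≟ j) (λ { refl → split }) ⟩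
      𝟙 (c ≟ j) * (𝟙 (j ≤? i) * 𝟙 (b ≟ i ∸ j))   ≡⟨ *-CS.x∙yz≈y∙xz (𝟙 (c ≟ j)) (𝟙 (j ≤? i)) _ ⟩
      𝟙 (j ≤? i) * (𝟙 (c ≟ j) * 𝟙 (b ≟ i ∸ j))   ∎
    where
    c = common u v
    b = beyond u v
    split : 𝟙 (weight v ≟ i) ≡ 𝟙 (c ≤? i) * 𝟙 (b ≟ i ∸ c)
    split = trans (cong (λ m → 𝟙 (m ≟ i)) (weight≡common+beyond u v)) (𝟙-+≟ c b i)

-- Profiles of neighbours

neighbour : ℕ → ℕ → ℕ → ℕ → ℕ
neighbour d' w i j = between 1 d' i * between 1 d' (distance w i j)

meetCount-vanishes : ∀ {w} z {i j} → ¬ j ≤ w ⊓ i → meetCount w z i j ≡ 0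
meetCount-vanishes {w} z {i} {j} j≰w⊓i with j ≤? i
... | no j≰i = cong (_* ((w C j) * (z C (i ∸ j)))) (𝟙-no (j ≤? i) j≰i)
... | yes j≤i = begin
    𝟙 (j ≤? i) * ((w C j) * (z C (i ∸ j)))  ≡⟨ cong (λ c → 𝟙 (j ≤? i) * (c * (z C (i ∸ j)))) (k>n⇒nCk≡0 w<j) ⟩
    𝟙 (j ≤? i) * 0                          ≡⟨ *-zeroʳ (𝟙 (j ≤? i)) ⟩
    0                                       ∎
  where
  open ≡-Reasoning
  w<j : w < j
  w<j = ≰⇒> (λ j≤w → j≰w⊓i (⊓-glb j≤w j≤i))

meetCount-within : ∀ {w} z {i j} → j ≤ i → meetCount w z i j ≡ (w C j) * (z C (i ∸ j))
meetCount-within {w} z {i} {j} j≤i =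
  trans (cong (_* ((w C j) * (z C (i ∸ j)))) (𝟙-yes (j ≤? i) j≤i)) (*-identityˡ _)

neighbour-off-diagonal : ∀ {w i j} d' → j ≤ w ⊓ i → ¬ (w ≡ j × w ≡ i) →
  between 1 d' (distance w i j) ≡ between (ceilHalfPos w i d') (w ⊓ i) j
neighbour-off-diagonal {w} {i} {j} d' j≤w⊓i off =
  𝟙-cong (mk⇔ to from) ((1 ≤? distance w i j) ×-dec (distance w i j ≤? d'))
                       ((ceilHalfPos w i d' ≤? j) ×-dec (j ≤? w ⊓ i))
  where
  open Equivalence (ceilHalfPos≤⇔ w i d' j) renaming (to to ceil≤⇒; from to ⇒ceil≤)
  to : 1 ≤ distance w i j × distance w i j ≤ d' → ceilHalfPos w i d' ≤ j × j ≤ w ⊓ i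
  to (_ , dist≤d') = ⇒ceil≤ dist≤d' , j≤w⊓i
  from : ceilHalfPos w i d' ≤ j × j ≤ w ⊓ i → 1 ≤ distance w i j × distance w i j ≤ d'
  from (ceil≤j , _) = n≢0⇒n>0 dist≢0 , ceil≤⇒ ceil≤j
    where
    dist≢0 : distance w i j ≢ 0
    dist≢0 dist≡0 with distance≡0⇒ (≤-trans j≤w⊓i (m⊓n≤m w i)) (≤-trans j≤w⊓i (m⊓n≤n w i)) dist≡0
    ... | w≡j , i≡j = off (w≡j , trans w≡j (sym i≡j))

-- The diagonal term is u's own profile (w, w): it is the one at distance 0, which `neighbour` excludes.
profile-identity : ∀ {w d'} z i j → 1 ≤ w → w ≤ d' →
  meetCount w z i j * neighbour d' w i j + 𝟙 (w ≟ j) * 𝟙 (w ≟ i) ≡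
  between 1 d' i * (between (ceilHalfPos w i d') (w ⊓ i) j * ((w C j) * (z C (i ∸ j))))
profile-identity {w} {d'} z i j 1≤w w≤d' with j ≤? w ⊓ i | (w ≟ j) ×-dec (w ≟ i)
... | no j≰w⊓i | _ = begin
    meetCount w z i j * neighbour d' w i j + 𝟙 (w ≟ j) * 𝟙 (w ≟ i)
  ≡⟨ cong₂ _+_ (cong (_* neighbour d' w i j) (meetCount-vanishes z j≰w⊓i))
               (trans (sym (𝟙-× (w ≟ j) (w ≟ i))) (𝟙-no ((w ≟ j) ×-dec (w ≟ i)) (j≰w⊓i ∘ diagonal-≤))) ⟩
    0
  ≡⟨ *-zeroʳ (between 1 d' i) ⟨
    between 1 d' i * 0
  ≡⟨ cong (λ t → between 1 d' i * (t * _))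
          (𝟙-no ((ceilHalfPos w i d' ≤? j) ×-dec (j ≤? w ⊓ i)) (j≰w⊓i ∘ proj₂)) ⟨
    between 1 d' i * (between (ceilHalfPos w i d') (w ⊓ i) j * ((w C j) * (z C (i ∸ j)))) ∎
  where
  open ≡-Reasoning
  diagonal-≤ : w ≡ j × w ≡ i → j ≤ w ⊓ i
  diagonal-≤ (refl , refl) = ≤-reflexive (sym (⊓-idem w))
... | yes _ | yes (refl , refl) = trans lhs≡1 (sym rhs≡1)
  where
  open ≡-Reasoning
  lhs≡1 : meetCount w z w w * neighbour d' w w w + 𝟙 (w ≟ w) * 𝟙 (w ≟ w) ≡ 1
  lhs≡1 = cong₂ _+_ (begin
      meetCount w z w w * (between 1 d' w * between 1 d' (distance w w w))
    ≡⟨ cong (λ k → meetCount w z w w * (between 1 d' w * between 1 d' k)) (distance-diagonal w) ⟩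
      meetCount w z w w * (between 1 d' w * 0)
    ≡⟨ trans (cong (meetCount w z w w *_) (*-zeroʳ (between 1 d' w))) (*-zeroʳ (meetCount w z w w)) ⟩
      0 ∎)
    (cong₂ _*_ (𝟙-yes (w ≟ w) refl) (𝟙-yes (w ≟ w) refl))
  ceil≤w : ceilHalfPos w w d' ≤ w
  ceil≤w = Equivalence.from (ceilHalfPos≤⇔ w w d' w) (subst (_≤ d') (sym (distance-diagonal w)) z≤n)
  rhs≡1 : between 1 d' w * (between (ceilHalfPos w w d') (w ⊓ w) w * ((w C w) * (z C (w ∸ w)))) ≡ 1
  rhs≡1 = begin
      between 1 d' w * (between (ceilHalfPos w w d') (w ⊓ w) w * ((w C w) * (z C (w ∸ w))))
    ≡⟨ cong₂ (λ s t → s * (t * ((w C w) * (z C (w ∸ w)))))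
             (𝟙-yes ((1 ≤? w) ×-dec (w ≤? d')) (1≤w , w≤d'))
             (𝟙-yes ((ceilHalfPos w w d' ≤? w) ×-dec (w ≤? w ⊓ w)) (ceil≤w , ≤-reflexive (sym (⊓-idem w)))) ⟩
      1 * (1 * ((w C w) * (z C (w ∸ w))))
    ≡⟨ cong₂ (λ a b → 1 * (1 * (a * (z C b)))) (nCn≡1 w) (n∸n≡0 w) ⟩
      1 ∎
... | yes j≤w⊓i | no off = begin
    meetCount w z i j * (between 1 d' i * between 1 d' (distance w i j)) + 𝟙 (w ≟ j) * 𝟙 (w ≟ i)
  ≡⟨ cong₂ _+_ (cong₂ (λ m t → m * (between 1 d' i * t))
                      (meetCount-within z j≤i) (neighbour-off-diagonal d' j≤w⊓i off))
               (trans (sym (𝟙-× (w ≟ j) (w ≟ i))) (𝟙-no ((w ≟ j) ×-dec (w ≟ i)) off)) ⟩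
    X * (between 1 d' i * between (ceilHalfPos w i d') (w ⊓ i) j) + 0
  ≡⟨ +-identityʳ _ ⟩
    X * (between 1 d' i * between (ceilHalfPos w i d') (w ⊓ i) j)
  ≡⟨ *-CS.x∙yz≈y∙zx X (between 1 d' i) _ ⟩
    between 1 d' i * (between (ceilHalfPos w i d') (w ⊓ i) j * X) ∎
  where
  open ≡-Reasoning
  X = (w C j) * (z C (i ∸ j))
  j≤i = ≤-trans j≤w⊓i (m⊓n≤n w i)

profile-sum : ∀ n d' w → 1 ≤ w → w ≤ d' → d' ≤ n →
  (∑[ i < suc n ] ∑[ j < suc n ] meetCount w (n ∸ w) i j * neighbour d' w i j) + 1 ≡ innerSum n d' w
profile-sum n d' w 1≤w w≤d' d'≤n = begin
    (∑[ i < N ] ∑[ j < N ] M i j) + 1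
  ≡⟨ cong ((∑[ i < N ] ∑[ j < N ] M i j) +_) diagonal-sum ⟨
    (∑[ i < N ] ∑[ j < N ] M i j) + (∑[ i < N ] ∑[ j < N ] δ i j)
  ≡⟨ ∑<-distrib-+ N (λ i → ∑[ j < N ] M i j) (λ i → ∑[ j < N ] δ i j) ⟨
    ∑[ i < N ] ((∑[ j < N ] M i j) + (∑[ j < N ] δ i j))
  ≡⟨ ∑<-cong N (λ i → sym (∑<-distrib-+ N (M i) (δ i))) ⟩
    ∑[ i < N ] ∑[ j < N ] (M i j + δ i j)
  ≡⟨ ∑<-cong N (λ i → ∑<-cong N (λ j → profile-identity z i j 1≤w w≤d')) ⟩
    ∑[ i < N ] ∑[ j < N ] between 1 d' i * (range i j * X i j)
  ≡⟨ ∑<-cong N (λ i → ∑<-distribˡ-* N (between 1 d' i) (λ j → range i j * X i j)) ⟩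
    ∑[ i < N ] between 1 d' i * (∑[ j < N ] range i j * X i j)
  ≡⟨ ∑<-cong N (λ i → cong (between 1 d' i *_) (sumFromTo-∑< (c i) (w ⊓ i) (X i) (w⊓i<N i))) ⟨
    ∑[ i < N ] between 1 d' i * sumFromTo (c i) (w ⊓ i) (X i)
  ≡⟨ sumFromTo-∑< 1 d' (λ i → sumFromTo (c i) (w ⊓ i) (X i)) (s≤s d'≤n) ⟨
    innerSum n d' w ∎
  where
  open ≡-Reasoning
  N = suc n
  z = n ∸ w
  c : ℕ → ℕ
  c i = ceilHalfPos w i d'
  M δ range X : ℕ → ℕ → ℕ
  M i j = meetCount w z i j * neighbour d' w i j
  δ i j = 𝟙 (w ≟ j) * 𝟙 (w ≟ i)
  range i j = between (c i) (w ⊓ i) j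
  X i j = (w C j) * (z C (i ∸ j))
  w<N : w < N
  w<N = s≤s (≤-trans w≤d' d'≤n)
  w⊓i<N : ∀ i → w ⊓ i < N
  w⊓i<N i = ≤-<-trans (m⊓n≤m w i) w<N
  diagonal-sum : ∑[ i < N ] ∑[ j < N ] δ i j ≡ 1
  diagonal-sum = trans (∑<-cong N (λ i → ∑<-δ N (λ _ → 𝟙 (w ≟ i)) w<N)) (∑<-𝟙≟ N w<N)

-- The sphere graph

degree : ∀ {n} → ℕ → Vec Bool n → ℕ
degree {n} d' u = ∑[ v ∈ allVecs n ] between 1 d' (weight v) * between 1 d' (hdist u v)

degree≡∑meetCount : ∀ {n} d' (u : Vec Bool n) →
  degree d' u ≡ ∑[ i < suc n ] ∑[ j < suc n ] meetCount (weight u) (n ∸ weight u) i j * neighbour d' (weight u) i j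
degree≡∑meetCount {n} d' u = begin
    degree d' u
  ≡⟨ ∑-cong (allVecs n) (λ v → cong (λ k → between 1 d' (weight v) * between 1 d' k) (hdist≡distance u v)) ⟩
    ∑[ v ∈ allVecs n ] neighbour d' w (weight v) (common u v)
  ≡⟨ ∑-fiber₂ weight (common u) (s≤s ∘ weight-≤) (s≤s ∘ common-≤ u) (allVecs n) (neighbour d' w) ⟩
    ∑[ i < N ] ∑[ j < N ] (∑[ v ∈ allVecs n ] 𝟙 (weight v ≟ i) * 𝟙 (common u v ≟ j)) * neighbour d' w i j
  ≡⟨ ∑<-cong N (λ i → ∑<-cong N (λ j → cong (_* neighbour d' w i j) (weight-common-count u i j))) ⟩
    ∑[ i < N ] ∑[ j < N ] meetCount w (n ∸ w) i j * neighbour d' w i j ∎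
  where
  open ≡-Reasoning
  N = suc n
  w = weight u

degree≡innerSum∸1 : ∀ {n} d' (u : Vec Bool n) → 1 ≤ weight u → weight u ≤ d' → d' ≤ n →
  degree d' u ≡ innerSum n d' (weight u) ∸ 1
degree≡innerSum∸1 {n} d' u 1≤w w≤d' d'≤n = begin
  degree d' u                   ≡⟨ m+n∸n≡m (degree d' u) 1 ⟨
  degree d' u + 1 ∸ 1           ≡⟨ cong (λ k → k + 1 ∸ 1) (degree≡∑meetCount d' u) ⟩
  profiles + 1 ∸ 1              ≡⟨ cong (_∸ 1) (profile-sum n d' (weight u) 1≤w w≤d' d'≤n) ⟩
  innerSum n d' (weight u) ∸ 1  ∎
  where
  open ≡-Reasoning
  profiles = ∑[ i < suc n ] ∑[ j < suc n ] meetCount (weight u) (n ∸ weight u) i j * neighbour d' (weight u) i j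

handshake : ∀ n d → 2 * sphereEdges n d ≡ ∑[ u ∈ allVecs n ] between 1 (d ∸ 1) (weight u) * degree (d ∸ 1) u
handshake n d = begin
    2 * sphereEdges n d
  ≡⟨ cong (2 *_) (length-filter (λ p → adjacent? d (proj₁ p) (proj₂ p)) (pairs V)) ⟩
    2 * (∑[ p ∈ pairs V ] adj (proj₁ p) (proj₂ p))
  ≡⟨ ∑-pairs adj (λ u v → cong (between 1 d') (hdist-sym u v)) (λ u → cong (between 1 d') (hdist-self u)) V ⟩
    ∑[ u ∈ V ] ∑[ v ∈ V ] adj u v
  ≡⟨ ∑-filter vertex? (allVecs n) (λ u → ∑[ v ∈ V ] adj u v) ⟩
    ∑[ u ∈ allVecs n ] between 1 d' (weight u) * (∑[ v ∈ V ] adj u v)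
  ≡⟨ ∑-cong (allVecs n) (λ u → cong (between 1 d' (weight u) *_) (∑-filter vertex? (allVecs n) (adj u))) ⟩
    ∑[ u ∈ allVecs n ] between 1 d' (weight u) * degree d' u ∎
  where
  open ≡-Reasoning
  d' = d ∸ 1
  V = sphereVertices n d
  adj : Vec Bool n → Vec Bool n → ℕ
  adj u v = between 1 d' (hdist u v)
  vertex? : (v : Vec Bool n) → Dec (1 ≤ weight v × weight v ≤ d')
  vertex? v = (1 ≤? weight v) ×-dec (weight v ≤? d')

∑-allVecs-byWeight : ∀ n a b (h : ℕ → ℕ) → b ≤ n →
  ∑[ u ∈ allVecs n ] between a b (weight u) * h (weight u) ≡ sumFromTo a b (λ w → (n C w) * h w)
∑-allVecs-byWeight n a b h b≤n = begin
    ∑[ u ∈ allVecs n ] between a b (weight u) * h (weight u)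
  ≡⟨ ∑-fiber₁ weight (s≤s ∘ weight-≤) (allVecs n) (λ w → between a b w * h w) ⟩
    ∑[ w < suc n ] (∑[ u ∈ allVecs n ] 𝟙 (weight u ≟ w)) * (between a b w * h w)
  ≡⟨ ∑<-cong (suc n) (λ w → trans (cong (_* (between a b w * h w)) (weight-count n w))
                                   (*-CS.x∙yz≈y∙xz (n C w) (between a b w) (h w))) ⟩
    ∑[ w < suc n ] between a b w * ((n C w) * h w)
  ≡⟨ sumFromTo-∑< a b (λ w → (n C w) * h w) (s≤s b≤n) ⟨
    sumFromTo a b (λ w → (n C w) * h w) ∎
  where open ≡-Reasoning

proposition9 : (n d : ℕ) → 1 ≤ d → d ≤ n →
    2 * sphereEdges n d ≡ edgeFormulaTimes2 n d
proposition9 n d _ d≤n = begin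
    2 * sphereEdges n d
  ≡⟨ handshake n d ⟩
    ∑[ u ∈ allVecs n ] between 1 d' (weight u) * degree d' u
  ≡⟨ ∑-cong (allVecs n) (λ u → 𝟙-*-cong ((1 ≤? weight u) ×-dec (weight u ≤? d'))
       (λ (1≤w , w≤d') → degree≡innerSum∸1 d' u 1≤w w≤d' d'≤n)) ⟩
    ∑[ u ∈ allVecs n ] between 1 d' (weight u) * (innerSum n d' (weight u) ∸ 1)
  ≡⟨ ∑-allVecs-byWeight n 1 d' (λ w → innerSum n d' w ∸ 1) d'≤n ⟩
    edgeFormulaTimes2 n d ∎
  where
  open ≡-Reasoning
  d' = d ∸ 1
  d'≤n = ≤-trans (m∸n≤m d 1) d≤n
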